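{- Let $n \ge 1$ and $s \ge 1$ be integers, and let $I = [i_0 : i_0+s-1]$ and $J = [j_0 : j_0+s-1]$ with $j_0 > i_0$ be two sub-intervals of $[0 : 2^n-1]$, each of size $s$, such that there exists a special bijection $P: I \to J$. Let $g:\mathbb{N}_0 \to \mathbb{R}$ be a non-decreasing function. Then: (1) $\sum_{i \in I} g(h(i)) \le \sum_{j \in J} g(h(j))$. (2) If $I$ and $J$ are non-overlapping (i.e. $i_0+s-1 < j_0$) and $g$ is strictly increasing, then $\sum_{i \in I} g(h(i)) < \sum_{j \in J} g(h(j))$. (3) For each $0 \le q \le n$ let $h_q:[0:2^n-1]\to\mathbb{N}_0$ be given by $h_q(i) = \binom{h(i)}{q}$. If $I$ and $J$ are non-overlapping, then for all $1 \le q \le n$, $\sum_{i \in I}\bigl(h_q(i) + h_{q-1}(i)\bigr) \le \sum_{j \in J} h_q(j)$.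
   Context: For non-negative integers $a,b$, $[a:b] = \{a, a+1, \ldots, b\}$ (empty if $a>b$). For $i \in [0:2^n-1]$, $h(i)$ denotes the number of ones in the binary representation of $i$. Given intervals $I = [i_0 : i_0+s-1]$ and $J = [j_0 : j_0+s-1]$ with $j_0 > i_0$, both sub-intervals of $[0:2^n-1]$, a bijection $P: I \to J$ is called special if $h(i) \le h(P(i))$ for every $i \in I$ and, in addition, all these inequalities are strict in case $I$ and $J$ are non-overlapping (i.e. in case $i_0+s-1 < j_0$). -}

module Defs where

open import Level using (Level; _⊔_)
open import Data.Nat using (ℕ; zero; suc; _+_; _∸_; _≤_; _<_)
open import Data.Nat.DivMod using (_/_; _%_)
open import Data.Fin using (Fin; toℕ)
open import Data.Product using (_×_)
open import Relation.Nullary using (¬_)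
open import Relation.Binary.Core using (Rel)
open import Relation.Binary.Structures using (IsTotalOrder)
open import Algebra.Structures using (IsAbelianGroup)
open import Function.Definitions using (Bijective)
open import Relation.Binary.PropositionalEquality using (_≡_)

hf : ℕ → ℕ → ℕ
hf zero    m = 0
hf (suc f) m = m % 2 + hf f (m / 2)

-- h i = number of ones in the binary representation of i
-- (fuel i suffices since i < 2^i).
h : ℕ → ℕ
h i = hf i i

-- A totally ordered abelian group (e.g. the additive group of ℝ with its order).
record OrderedAbelianGroup c ℓ₁ ℓ₂ : Set (Level.suc (c ⊔ ℓ₁ ⊔ ℓ₂)) where
  infix  4 _≈_ _≤ᴳ_ _<ᴳ_
  infixl 6 _+ᴳ_
  field
    Carrier        : Set c
    _≈_            : Rel Carrier ℓ₁
    _≤ᴳ_            : Rel Carrier ℓ₂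
    _+ᴳ_            : Carrier → Carrier → Carrier
    0#             : Carrier
    -_             : Carrier → Carrier
    isAbelianGroup : IsAbelianGroup _≈_ _+ᴳ_ 0# -_
    isTotalOrder   : IsTotalOrder _≈_ _≤ᴳ_
    +-monoˡ-≤      : ∀ z {x y} → x ≤ᴳ y → (x +ᴳ z) ≤ᴳ (y +ᴳ z)

  _<ᴳ_ : Rel Carrier (ℓ₁ ⊔ ℓ₂)
  x <ᴳ y = (x ≤ᴳ y) × ¬ (x ≈ y)

  sumFrom : (ℕ → Carrier) → ℕ → ℕ → Carrier
  sumFrom f a zero    = 0#
  sumFrom f a (suc s) = f a +ᴳ sumFrom f (suc a) s

sumℕ : (ℕ → ℕ) → ℕ → ℕ → ℕ
sumℕ f a zero    = 0
sumℕ f a (suc s) = f a + sumℕ f (suc a) s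

NonOverlapping : ℕ → ℕ → ℕ → Set
NonOverlapping i0 j0 s = i0 + s ∸ 1 < j0

-- A bijection P : [i0 : i0+s-1] → [j0 : j0+s-1] is represented by a bijection
-- P' : Fin s → Fin s via P (i0 + k) = j0 + P' k.
IsSpecial : (i0 j0 s : ℕ) → (Fin s → Fin s) → Set
IsSpecial i0 j0 s P =
  Bijective _≡_ _≡_ P
  × (∀ k → h (i0 + toℕ k) ≤ h (j0 + toℕ (P k)))
  × (NonOverlapping i0 j0 s → ∀ k → h (i0 + toℕ k) < h (j0 + toℕ (P k)))

-- Reindexing the sum over J along the special bijection P turns both sums into sums over
-- the same finite index set, compared termwise: g (h i) ≤ g (h (P i)) by monotonicity of g,
-- strictly when g and the special inequalities are strict. For (3) the strict inequality
-- h i < h (P i) feeds Pascal's rule h i C q + h i C (q - 1) = (1 + h i) C q, and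
-- (1 + h i) C q ≤ h (P i) C q since n C q is monotone in n.
module Submission where

open import Defs
open import Data.Nat using (ℕ; _+_; _∸_; _≤_; _<_; _^_)
open import Data.Nat.Combinatorics using (_C_)
open import Data.Fin using (Fin)
open import Data.Product using (_×_; ∃)

open import Algebra.Bundles using (CommutativeMonoid)
import Algebra.Properties.CommutativeMonoid.Sum as CommutativeMonoidSum
import Algebra.Properties.Group as GroupProperties
open import Algebra.Structures using (IsAbelianGroup)
open import Data.Fin using (zero; suc; toℕ)
open import Data.Fin.Permutation using (Permutation)
open import Data.Nat using (zero; suc; _≤′_; ≤′-refl; ≤′-step)
import Data.Nat.Properties as ℕ
open import Data.Nat.Combinatorics using (nCk+nC[k+1]≡[n+1]C[k+1])
open import Data.Product using (_,_; proj₁)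
open import Function.Base using (_∘_)
open import Function.Bundles using (mk⤖)
open import Function.Definitions using (Bijective)
open import Function.Properties.Bijection using (⤖⇒↔)
open import Relation.Binary.Bundles using (Poset)
open import Relation.Binary.Core using (Rel)
open import Relation.Binary.PropositionalEquality using (_≡_; refl; cong; cong₂; subst; sym; trans)
open import Relation.Binary.Structures using (IsPreorder; IsTotalOrder)
import Relation.Binary.Reasoning.PartialOrder as PosetReasoning

bijective⇒permutation : ∀ {s} {P : Fin s → Fin s} → Bijective _≡_ _≡_ P → Permutation s s
bijective⇒permutation bij = ⤖⇒↔ (mk⤖ bij)

module SumComparison
  {a ℓ₁ ℓ₂} (M : CommutativeMonoid a ℓ₁)
  {_≤_ : Rel (CommutativeMonoid.Carrier M) ℓ₂}
  (≤-isPreorder : IsPreorder (CommutativeMonoid._≈_ M) _≤_)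
  (∙-mono-≤ : ∀ {x y u v} → x ≤ y → u ≤ v → CommutativeMonoid._∙_ M x u ≤ CommutativeMonoid._∙_ M y v)
  where

  open CommutativeMonoid M using (Carrier) renaming (sym to ≈-sym)
  open CommutativeMonoidSum M using (sum; sum-permute)
  open IsPreorder ≤-isPreorder using (reflexive) renaming (refl to ≤-refl; trans to ≤-trans)

  ∑-mono-≤ : ∀ {s} {f g : Fin s → Carrier} → (∀ k → f k ≤ g k) → sum f ≤ sum g
  ∑-mono-≤ {zero}  f≤g = ≤-refl
  ∑-mono-≤ {suc s} f≤g = ∙-mono-≤ (f≤g zero) (∑-mono-≤ (λ k → f≤g (suc k)))

  ∑-reindex-≤ : ∀ {s} {f g : Fin s → Carrier} {P : Fin s → Fin s} → Bijective _≡_ _≡_ P →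
                (∀ k → f k ≤ g (P k)) → sum f ≤ sum g
  ∑-reindex-≤ {g = g} bij f≤gP =
    ≤-trans (∑-mono-≤ f≤gP) (reflexive (≈-sym (sum-permute g (bijective⇒permutation bij))))

module OrderedAbelianGroupProperties {c ℓ₁ ℓ₂} (G : OrderedAbelianGroup c ℓ₁ ℓ₂) where
  open OrderedAbelianGroup G
  open IsAbelianGroup isAbelianGroup using (isCommutativeMonoid; isGroup; comm; ∙-congˡ)
    renaming (refl to ≈-refl; sym to ≈-sym)
  open IsTotalOrder isTotalOrder using (isPartialOrder; isPreorder; antisym; reflexive)
    renaming (trans to ≤-trans)

  commutativeMonoid : CommutativeMonoid c ℓ₁
  commutativeMonoid = record { isCommutativeMonoid = isCommutativeMonoid }

  poset : Poset c ℓ₁ ℓ₂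
  poset = record { isPartialOrder = isPartialOrder }

  open CommutativeMonoidSum commutativeMonoid using (sum; sum-syntax; sum-permute; sum-cong-≗)
  open PosetReasoning poset

  +-monoʳ-≤ : ∀ z {x y} → x ≤ᴳ y → z +ᴳ x ≤ᴳ z +ᴳ y
  +-monoʳ-≤ z {x} {y} x≤y = begin
    z +ᴳ x  ≈⟨ comm z x ⟩
    x +ᴳ z  ≤⟨ +-monoˡ-≤ z x≤y ⟩
    y +ᴳ z  ≈⟨ comm y z ⟩
    z +ᴳ y  ∎

  +-mono-≤ : ∀ {x y u v} → x ≤ᴳ y → u ≤ᴳ v → x +ᴳ u ≤ᴳ y +ᴳ v
  +-mono-≤ {y = y} {u = u} x≤y u≤v = ≤-trans (+-monoˡ-≤ u x≤y) (+-monoʳ-≤ y u≤v)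

  +-mono-<-≤ : ∀ {x y u v} → x <ᴳ y → u ≤ᴳ v → x +ᴳ u <ᴳ y +ᴳ v
  +-mono-<-≤ {x} {y} {u} {v} (x≤y , x≉y) u≤v = +-mono-≤ x≤y u≤v , λ x+u≈y+v →
    x≉y (GroupProperties.∙-cancelʳ (record { isGroup = isGroup }) u x y
          (antisym (+-monoˡ-≤ u x≤y) (≤-trans (+-monoʳ-≤ y u≤v) (reflexive (≈-sym x+u≈y+v)))))

  open SumComparison commutativeMonoid isPreorder +-mono-≤ public

  ∑-mono-< : ∀ {s} {f g : Fin (suc s) → Carrier} → (∀ k → f k <ᴳ g k) → sum f <ᴳ sum g
  ∑-mono-< f<g = +-mono-<-≤ (f<g zero) (∑-mono-≤ (λ k → proj₁ (f<g (suc k))))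

  ∑-reindex-< : ∀ {s} {f g : Fin (suc s) → Carrier} {P : Fin (suc s) → Fin (suc s)} →
                Bijective _≡_ _≡_ P → (∀ k → f k <ᴳ g (P k)) → sum f <ᴳ sum g
  ∑-reindex-< {f = f} {g} {P} bij f<gP = begin-strict
    sum f        <⟨ ∑-mono-< f<gP ⟩
    sum (g ∘ P)  ≈⟨ sum-permute g (bijective⇒permutation bij) ⟨
    sum g        ∎

  sumFrom≈∑ : ∀ f a s → sumFrom f a s ≈ ∑[ k < s ] f (a + toℕ k)
  sumFrom≈∑ f a zero    = ≈-refl
  sumFrom≈∑ f a (suc s) = begin-equality
    f a +ᴳ sumFrom f (suc a) s                ≈⟨ ∙-congˡ (sumFrom≈∑ f (suc a) s) ⟩
    f a +ᴳ ∑[ k < s ] f (suc a + toℕ k)       ≡⟨ cong₂ _+ᴳ_ (cong f (sym (ℕ.+-identityʳ a)))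
                                                   (sum-cong-≗ {s} (λ k → cong f (sym (ℕ.+-suc a (toℕ k))))) ⟩
    ∑[ k < suc s ] f (a + toℕ k)              ∎

  sumFrom-≤-via : ∀ {s} (f g : ℕ → Carrier) (a b : ℕ) {P : Fin s → Fin s} → Bijective _≡_ _≡_ P →
                  (∀ k → f (a + toℕ k) ≤ᴳ g (b + toℕ (P k))) → sumFrom f a s ≤ᴳ sumFrom g b s
  sumFrom-≤-via {s} f g a b bij f≤gP = begin
    sumFrom f a s               ≈⟨ sumFrom≈∑ f a s ⟩
    ∑[ k < s ] f (a + toℕ k)    ≤⟨ ∑-reindex-≤ {g = λ k → g (b + toℕ k)} bij f≤gP ⟩
    ∑[ k < s ] g (b + toℕ k)    ≈⟨ sumFrom≈∑ g b s ⟨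
    sumFrom g b s               ∎

  sumFrom-<-via : ∀ {s} (f g : ℕ → Carrier) (a b : ℕ) {P : Fin (suc s) → Fin (suc s)} →
                  Bijective _≡_ _≡_ P → (∀ k → f (a + toℕ k) <ᴳ g (b + toℕ (P k))) →
                  sumFrom f a (suc s) <ᴳ sumFrom g b (suc s)
  sumFrom-<-via {s} f g a b bij f<gP = begin-strict
    sumFrom f a (suc s)             ≈⟨ sumFrom≈∑ f a (suc s) ⟩
    ∑[ k < suc s ] f (a + toℕ k)    <⟨ ∑-reindex-< {g = λ k → g (b + toℕ k)} bij f<gP ⟩
    ∑[ k < suc s ] g (b + toℕ k)    ≈⟨ sumFrom≈∑ g b (suc s) ⟨
    sumFrom g b (suc s)             ∎

module NatSum where
  open CommutativeMonoidSum ℕ.+-0-commutativeMonoid using (sum-syntax; sum-cong-≗)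
  open SumComparison ℕ.+-0-commutativeMonoid ℕ.≤-isPreorder ℕ.+-mono-≤
  open ℕ.≤-Reasoning

  sumℕ≡∑ : ∀ f a s → sumℕ f a s ≡ ∑[ k < s ] f (a + toℕ k)
  sumℕ≡∑ f a zero    = refl
  sumℕ≡∑ f a (suc s) = cong₂ _+_ (cong f (sym (ℕ.+-identityʳ a)))
    (trans (sumℕ≡∑ f (suc a) s) (sum-cong-≗ {s} (λ k → cong f (sym (ℕ.+-suc a (toℕ k))))))

  sumℕ-≤-via : ∀ {s} (f g : ℕ → ℕ) (a b : ℕ) {P : Fin s → Fin s} → Bijective _≡_ _≡_ P →
               (∀ k → f (a + toℕ k) ≤ g (b + toℕ (P k))) → sumℕ f a s ≤ sumℕ g b s
  sumℕ-≤-via {s} f g a b bij f≤gP = begin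
    sumℕ f a s                  ≡⟨ sumℕ≡∑ f a s ⟩
    ∑[ k < s ] f (a + toℕ k)    ≤⟨ ∑-reindex-≤ {g = λ k → g (b + toℕ k)} bij f≤gP ⟩
    ∑[ k < s ] g (b + toℕ k)    ≡⟨ sumℕ≡∑ g b s ⟨
    sumℕ g b s                  ∎

open NatSum using (sumℕ-≤-via)

nCk≤[n+1]Ck : ∀ n k → n C k ≤ suc n C k
nCk≤[n+1]Ck n zero    = ℕ.≤-refl
nCk≤[n+1]Ck n (suc k) = subst (n C suc k ≤_) (nCk+nC[k+1]≡[n+1]C[k+1] n k) (ℕ.m≤n+m (n C suc k) (n C k))

C-monoˡ-≤ : ∀ k {m n} → m ≤ n → m C k ≤ n C k
C-monoˡ-≤ k m≤n = go (ℕ.≤⇒≤′ m≤n)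
  where
  go : ∀ {m n} → m ≤′ n → m C k ≤ n C k
  go ≤′-refl          = ℕ.≤-refl
  go (≤′-step {n} m≤n) = ℕ.≤-trans (go m≤n) (nCk≤[n+1]Ck n k)

nC[k+1]+nCk≤mC[k+1] : ∀ k {n m} → n < m → n C suc k + n C k ≤ m C suc k
nC[k+1]+nCk≤mC[k+1] k {n} {m} n<m = begin
  n C suc k + n C k    ≡⟨ ℕ.+-comm (n C suc k) (n C k) ⟩
  n C k + n C suc k    ≡⟨ nCk+nC[k+1]≡[n+1]C[k+1] n k ⟩
  suc n C suc k        ≤⟨ C-monoˡ-≤ (suc k) n<m ⟩
  m C suc k            ∎
  where open ℕ.≤-Reasoning

lemma2 : ∀ {c ℓ₁ ℓ₂} (G : OrderedAbelianGroup c ℓ₁ ℓ₂) →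
  (n s i0 j0 : ℕ) → 1 ≤ n → 1 ≤ s → i0 < j0 → j0 + s ∸ 1 ≤ 2 ^ n ∸ 1 →
  ∃ (λ (P : Fin s → Fin s) → IsSpecial i0 j0 s P) →
  let open OrderedAbelianGroup G in
  ((g : ℕ → Carrier) → (∀ a b → a ≤ b → g a ≤ᴳ g b) →
    sumFrom (λ i → g (h i)) i0 s ≤ᴳ sumFrom (λ j → g (h j)) j0 s)
  × ((g : ℕ → Carrier) → NonOverlapping i0 j0 s → (∀ a b → a < b → g a <ᴳ g b) →
    sumFrom (λ i → g (h i)) i0 s <ᴳ sumFrom (λ j → g (h j)) j0 s)
  × (NonOverlapping i0 j0 s → (q : ℕ) → 1 ≤ q → q ≤ n →
    sumℕ (λ i → h i C q + h i C (q ∸ 1)) i0 s ≤ sumℕ (λ j → h j C q) j0 s)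
-- Only the special bijection matters.
lemma2 G n (suc s) i0 j0 _ _ _ _ (P , bij , h≤hP , h<hP) =
  (λ g g-mono → sumFrom-≤-via _ _ i0 j0 bij (λ k → g-mono _ _ (h≤hP k))) ,
  (λ g disjoint g-mono → sumFrom-<-via _ _ i0 j0 bij (λ k → g-mono _ _ (h<hP disjoint k))) ,
  λ { disjoint (suc q) _ _ → sumℕ-≤-via _ _ i0 j0 bij (λ k → nC[k+1]+nCk≤mC[k+1] q (h<hP disjoint k)) }
  where open OrderedAbelianGroupProperties G
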